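{- Let $m>1$ be an integer with $m\equiv 1\pmod 3$. Then for every integer $j\ge 0$, $$\sum_{i=1}^{mj+1} sp(i,m)\equiv 1\pmod 3.$$
   Context: For fixed $m>1$, $sp(n,m)$ is defined by: $sp(n,m)=0$ for $n<0$, $sp(0,m)=1$, $sp(n,m)=1$ for $1\le n\le m-1$, and for $n\ge m$: $sp(n,m)=sp(n/m,m)$ if $m\mid n$, and $sp(n,m)=2sp(n-r,m)+sp(n-m,m)$ if $n\equiv r\pmod m$ with $0<r<m$. (It counts semi-$m$-Pell compositions of $n$.) -}

module Defs where

open import Data.Nat using (ℕ; zero; suc; _+_; _*_; _∸_; _<ᵇ_; _≡ᵇ_)
open import Data.Nat.DivMod using (_%_; _/_)
open import Data.Bool using (if_then_else_)

-- Fuel-bounded evaluation of the recursion defining sp(n,m).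
-- Every recursive call strictly decreases n (for m > 1), so fuel n+1 suffices.
-- The divisor of % and / is written suc (m ∸ 1), which equals m whenever m ≥ 1.
spF : ℕ → ℕ → ℕ → ℕ
spF zero    n m = 0
spF (suc f) n m =
  if n <ᵇ m then 1
  else if (n % suc (m ∸ 1)) ≡ᵇ 0 then spF f (n / suc (m ∸ 1)) m
  else 2 * spF f (n ∸ (n % suc (m ∸ 1))) m + spF f (n ∸ m) m

-- sp n m  =  sp(n, m) of the paper (meaningful for m > 1; n ranges over ℕ,
-- negative arguments never arise in the recursion for n ≥ m).
sp : ℕ → ℕ → ℕ
sp n m = spF (suc n) n m

sum1 : ℕ → (ℕ → ℕ) → ℕ
sum1 zero    f = 0
sum1 (suc k) f = sum1 k f + f (suc k)

module Submission where

open import Defs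
open import Data.Nat using (ℕ; _+_; _*_; _<_)
open import Data.Nat.DivMod using (_%_)
open import Relation.Binary.PropositionalEquality using (_≡_)

open import Data.Bool using (true; false; T)
open import Data.List using (_∷_; [])
open import Data.Nat using (zero; suc; _∸_; _≤_; z≤n; s≤s; _<ᵇ_; _≡ᵇ_; NonZero)
open import Data.Nat.Divisibility using (_∣_; divides)
open import Data.Nat.DivMod using (_/_; m/n<m; [m+kn]%n≡m%n; m<n⇒m%n≡m; m≡m%n+[m/n]*n)
open import Data.Nat.Properties
open import Data.Nat.Tactic.RingSolver using (solve; solve-∀)
open import Data.Sum using (inj₁; inj₂)
open import Relation.Binary.PropositionalEquality
  using (refl; sym; trans; cong; cong₂; subst; module ≡-Reasoning)
open import Relation.Nullary using (contradiction)

-- Write m = 2 + k. For 0 < r < m the recursion gives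
--   sp(m(j+1) + r) = 2 sp(m(j+1)) + sp(mj + r),
-- so by induction on j the value sp(mj + r) does not depend on r; call it b_j.
-- With a = sp(m(j+1)), the m terms sp(i) for mj+1 < i ≤ m(j+1)+1 are k copies
-- of b_j, then a, then 2a + b_j, which add up to (m - 1) b_j + 3a.  When
-- m ≡ 1 (mod 3) this is divisible by 3, so the partial sums at mj+1 stay ≡ sp(1) = 1.

<ᵇ≡false⇒≥ : ∀ {m n} → (n <ᵇ m) ≡ false → m ≤ n
<ᵇ≡false⇒≥ n<ᵇm = ≮⇒≥ (λ n<m → subst T n<ᵇm (<⇒<ᵇ n<m))

≥⇒<ᵇ≡false : ∀ {m n} → m ≤ n → (n <ᵇ m) ≡ false
≥⇒<ᵇ≡false {m} {n} m≤n with n <ᵇ m in n<ᵇm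
... | false = refl
... | true  = contradiction (<ᵇ⇒< n m (subst T (sym n<ᵇm) _)) (≤⇒≯ m≤n)

≡ᵇ0≡false⇒>0 : ∀ {n} → (n ≡ᵇ 0) ≡ false → 0 < n
≡ᵇ0≡false⇒>0 {suc n} _ = s≤s z≤n

>0⇒≡ᵇ0≡false : ∀ {n} → 0 < n → (n ≡ᵇ 0) ≡ false
>0⇒≡ᵇ0≡false {suc n} _ = refl

m∸n<m : ∀ m n → 0 < m → 0 < n → m ∸ n < m
m∸n<m (suc m) (suc n) _ _ = s≤s (m∸n≤m m n)

*-suc-+ : ∀ m j r → m * suc j + r ≡ m * j + r + m
*-suc-+ = solve-∀

m%n≡1⇒n∣m∸1 : ∀ m n .{{_ : NonZero n}} → m % n ≡ 1 → n ∣ m ∸ 1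
m%n≡1⇒n∣m∸1 m n m%n≡1 =
  divides (m / n) (cong (_∸ 1) (trans (m≡m%n+[m/n]*n m n) (cong (_+ (m / n) * n) m%n≡1)))

sum1-+ : ∀ (f : ℕ → ℕ) a b → sum1 (a + b) f ≡ sum1 a f + sum1 b (λ i → f (a + i))
sum1-+ f a zero    = trans (cong (λ x → sum1 x f) (+-identityʳ a)) (sym (+-identityʳ _))
sum1-+ f a (suc b) rewrite +-suc a b | sum1-+ f a b =
  +-assoc (sum1 a f) (sum1 b (λ i → f (a + i))) (f (suc (a + b)))

sum1-const : ∀ (f : ℕ → ℕ) c n → (∀ i → 0 < i → i ≤ n → f i ≡ c) → sum1 n f ≡ n * c
sum1-const f c zero    _      = refl
sum1-const f c (suc n) f≡c =
  trans (cong₂ _+_ (sum1-const f c n (λ i 0<i i≤n → f≡c i 0<i (m≤n⇒m≤1+n i≤n)))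
                   (f≡c (suc n) (s≤s z≤n) ≤-refl))
        (+-comm (n * c) c)

-- Taking m = 2 + k makes the divisor suc (m ∸ 1) of spF definitionally m.
module SemiPell (k : ℕ) where

  m : ℕ
  m = 2 + k

  m≤n⇒n/m<n : ∀ {n} → m ≤ n → n / m < n
  m≤n⇒n/m<n {suc n} _ = m/n<m (suc n) m (s≤s (s≤s z≤n))

  spF-fuel-suc : ∀ f n → n < f → spF f n m ≡ spF (suc f) n m
  spF-fuel-suc (suc f) n n<f with n <ᵇ m in n<ᵇm
  ... | true  = refl
  ... | false with n % m ≡ᵇ 0 in n%m≡ᵇ0
  ...   | true  = spF-fuel-suc f (n / m)
                    (<-≤-trans (m≤n⇒n/m<n (<ᵇ≡false⇒≥ n<ᵇm)) (≤-pred n<f))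
  ...   | false = cong₂ (λ x y → 2 * x + y)
                    (spF-fuel-suc f (n ∸ n % m)
                      (<-≤-trans (m∸n<m n (n % m) 0<n (≡ᵇ0≡false⇒>0 n%m≡ᵇ0)) (≤-pred n<f)))
                    (spF-fuel-suc f (n ∸ m) (<-≤-trans (m∸n<m n m 0<n (s≤s z≤n)) (≤-pred n<f)))
    where 0<n : 0 < n
          0<n = <-≤-trans (s≤s z≤n) (<ᵇ≡false⇒≥ n<ᵇm)

  spF≡sp : ∀ f n → n < f → spF f n m ≡ sp n m
  spF≡sp (suc f) n n<1+f with m≤n⇒m<n∨m≡n (≤-pred n<1+f)
  ... | inj₂ refl = refl
  ... | inj₁ n<f  = trans (sym (spF-fuel-suc f n n<f)) (spF≡sp f n n<f)

  sp-small : ∀ n → n < m → sp n m ≡ 1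
  sp-small n n<m with n <ᵇ m in n<ᵇm
  ... | true  = refl
  ... | false = contradiction n<m (≤⇒≯ (<ᵇ≡false⇒≥ n<ᵇm))

  sp-nondivisible : ∀ n → m ≤ n → 0 < n % m →
                    sp n m ≡ 2 * sp (n ∸ n % m) m + sp (n ∸ m) m
  sp-nondivisible n m≤n 0<n%m
    rewrite ≥⇒<ᵇ≡false m≤n | >0⇒≡ᵇ0≡false 0<n%m =
      cong₂ (λ x y → 2 * x + y)
        (spF≡sp n (n ∸ n % m) (m∸n<m n (n % m) 0<n 0<n%m))
        (spF≡sp n (n ∸ m) (m∸n<m n m 0<n (s≤s z≤n)))
    where 0<n : 0 < n
          0<n = <-≤-trans (s≤s z≤n) m≤n

  sp-next-row : ∀ j r → 0 < r → r < m →
                sp (m * suc j + r) m ≡ 2 * sp (m * suc j) m + sp (m * j + r) m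
  sp-next-row j r 0<r r<m =
    trans (sp-nondivisible n m≤n (subst (0 <_) (sym n%m≡r) 0<r))
          (cong₂ (λ x y → 2 * sp x m + sp y m) n∸n%m≡ n∸m≡)
    where
    open ≡-Reasoning
    n : ℕ
    n = m * suc j + r
    n≡ : n ≡ m * j + r + m
    n≡ = *-suc-+ m j r
    m≤n : m ≤ n
    m≤n = subst (m ≤_) (sym n≡) (m≤n+m m (m * j + r))
    n%m≡r : n % m ≡ r
    n%m≡r = begin
      (m * suc j + r) % m ≡⟨ cong (_% m) (+-comm (m * suc j) r) ⟩
      (r + m * suc j) % m ≡⟨ cong (λ x → (r + x) % m) (*-comm m (suc j)) ⟩
      (r + suc j * m) % m ≡⟨ [m+kn]%n≡m%n r (suc j) m ⟩
      r % m               ≡⟨ m<n⇒m%n≡m r<m ⟩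
      r                   ∎
    n∸n%m≡ : n ∸ n % m ≡ m * suc j
    n∸n%m≡ = trans (cong (n ∸_) n%m≡r) (m+n∸n≡m (m * suc j) r)
    n∸m≡ : n ∸ m ≡ m * j + r
    n∸m≡ = trans (cong (_∸ m) n≡) (m+n∸n≡m (m * j + r) m)

  sp-row-constant : ∀ j r → 0 < r → r < m → sp (m * j + r) m ≡ sp (m * j + 1) m
  sp-row-constant zero    r 0<r r<m rewrite *-zeroʳ m =
    trans (sp-small r r<m) (sym (sp-small 1 (s≤s (s≤s z≤n))))
  sp-row-constant (suc j) r 0<r r<m = begin
    sp (m * suc j + r) m                  ≡⟨ sp-next-row j r 0<r r<m ⟩
    2 * sp (m * suc j) m + sp (m * j + r) m ≡⟨ cong (2 * sp (m * suc j) m +_) (sp-row-constant j r 0<r r<m) ⟩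
    2 * sp (m * suc j) m + sp (m * j + 1) m ≡⟨ sym (sp-next-row j 1 (s≤s z≤n) (s≤s (s≤s z≤n))) ⟩
    sp (m * suc j + 1) m                  ∎
    where open ≡-Reasoning

  row-sum : ∀ j → sum1 m (λ i → sp (m * j + 1 + i) m)
                  ≡ suc k * sp (m * j + 1) m + 3 * sp (m * suc j) m
  row-sum j = begin
    sum1 k h + h (suc k) + h (2 + k)  ≡⟨ cong₂ (λ x y → x + y + h (2 + k)) inner last-but-one ⟩
    k * b + a + h (2 + k)             ≡⟨ cong (k * b + a +_) last ⟩
    k * b + a + (2 * a + b)           ≡⟨ regroup a b ⟩
    suc k * b + 3 * a                 ∎
    where
    open ≡-Reasoning
    h : ℕ → ℕ
    h i = sp (m * j + 1 + i) m
    a b : ℕ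
    a = sp (m * suc j) m
    b = sp (m * j + 1) m
    inner : sum1 k h ≡ k * b
    inner = sum1-const h b k (λ i 0<i i≤k →
      trans (cong (λ x → sp x m) (+-assoc (m * j) 1 i))
            (sp-row-constant j (suc i) (s≤s z≤n) (s≤s (s≤s i≤k))))
    last-but-one : h (suc k) ≡ a
    last-but-one = cong (λ x → sp x m)
      (trans (+-assoc (m * j) 1 (suc k)) (trans (+-comm (m * j) m) (sym (*-suc m j))))
    last : h (2 + k) ≡ 2 * a + b
    last = trans (cong (λ x → sp x m) (sym (*-suc-+ m j 1)))
                 (sp-next-row j 1 (s≤s z≤n) (s≤s (s≤s z≤n)))
    regroup : ∀ x y → k * y + x + (2 * x + y) ≡ suc k * y + 3 * x
    regroup x y = solve (k ∷ x ∷ y ∷ [])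

  sum-sp-mod3 : 3 ∣ suc k → ∀ j → sum1 (m * j + 1) (λ i → sp i m) % 3 ≡ 1
  sum-sp-mod3 _ zero rewrite *-zeroʳ m | sp-small 1 (s≤s (s≤s z≤n)) = refl
  sum-sp-mod3 3∣k+1@(divides p k+1≡p*3) (suc j) = begin
    sum1 (m * suc j + 1) g % 3        ≡⟨ cong (λ x → sum1 x g % 3) (*-suc-+ m j 1) ⟩
    sum1 (m * j + 1 + m) g % 3        ≡⟨ cong (_% 3) (sum1-+ g (m * j + 1) m) ⟩
    (S + sum1 m (λ i → g (m * j + 1 + i))) % 3 ≡⟨ cong (λ x → (S + x) % 3) (row-sum j) ⟩
    (S + (suc k * b + 3 * a)) % 3     ≡⟨ cong (λ x → (S + x) % 3) row≡ ⟩
    (S + (p * b + a) * 3) % 3         ≡⟨ [m+kn]%n≡m%n S (p * b + a) 3 ⟩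
    S % 3                             ≡⟨ sum-sp-mod3 3∣k+1 j ⟩
    1                                 ∎
    where
    open ≡-Reasoning
    g : ℕ → ℕ
    g i = sp i m
    S : ℕ
    S = sum1 (m * j + 1) g
    a b : ℕ
    a = sp (m * suc j) m
    b = sp (m * j + 1) m
    row≡ : suc k * b + 3 * a ≡ (p * b + a) * 3
    row≡ = trans (cong (λ c → c * b + 3 * a) k+1≡p*3) (factor a b)
      where factor : ∀ x y → p * 3 * y + 3 * x ≡ (p * y + x) * 3
            factor x y = solve (p ∷ x ∷ y ∷ [])

lemma4p4 : (m : ℕ) → 1 < m → m % 3 ≡ 1 → (j : ℕ) →
    sum1 (m * j + 1) (λ i → sp i m) % 3 ≡ 1
lemma4p4 (suc zero)    (s≤s ()) _
lemma4p4 (suc (suc k)) _        m%3≡1 =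
  SemiPell.sum-sp-mod3 k (m%n≡1⇒n∣m∸1 (suc (suc k)) 3 m%3≡1)
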